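{- Let $r,\tilde r\geq 1$. Let $\mathcal{G}$ be a CPR graph on a finite vertex set $\Omega_1$ with labels $0,1,\dots,r-1$, and suppose that $\mathcal{G}$ has a vertex $A$ which is incident with exactly one edge, this edge has label $0$, and every other edge of $\mathcal{G}$ has label at least $1$. Let $\tilde{\mathcal{G}}$ be a CPR graph on a finite vertex set $\Omega_2$ (disjoint from $\Omega_1$) with labels $0,1,\dots,\tilde r-1$, and suppose that $\tilde{\mathcal{G}}$ has a vertex $B$ which is incident with exactly one edge, this edge has label $0$, and every other edge of $\tilde{\mathcal{G}}$ has label at least $1$. Let $\mathcal{H}$ be the edge-labelled multigraph obtained from the disjoint union of $\mathcal{G}$ and $\tilde{\mathcal{G}}$ by identifying $A$ and $B$ into a single vertex $C$, and by replacing the label $l$ of every edge coming from $\mathcal{G}$ by the label $-(l+1)$ (edges coming from $\tilde{\mathcal{G}}$ keep their labels). Then $\mathcal{H}$, with labels $-r,-r+1,\dots,-1,0,1,\dots,\tilde r-1$ ordered increasingly, is a CPR graph.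
   Context: A string group generated by involutions (sggi) of rank $r$ is a group $G$ together with an ordered sequence $(\rho_0,\dots,\rho_{r-1})$ of involutions generating $G$ such that $(\rho_i\rho_j)^2=1$ whenever $|i-j|\geq 2$. It is a string C-group if moreover it satisfies the intersection property: $\langle \rho_i : i\in I\rangle\cap\langle\rho_j : j\in J\rangle=\langle \rho_k : k\in I\cap J\rangle$ for all $I,J\subseteq\{0,\dots,r-1\}$. Let $\Omega$ be a finite set and $L$ a set of consecutive integers (ordered increasingly). An edge-labelled multigraph on vertex set $\Omega$ with labels in $L$, in which every vertex is incident with at most one edge of each label and every label of $L$ occurs, determines for each $l\in L$ the involution $\rho_l\in\mathrm{Sym}(\Omega)$ equal to the product of the transpositions $(a\,b)$ over all edges $\{a,b\}$ of label $l$. The graph is then the permutation representation graph of the group $\langle\rho_l : l\in L\rangle$ with generating sequence $(\rho_l)_{l\in L}$ in increasing order of labels, and it is called a CPR graph if this group with this generating sequence is a string C-group. -}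

module Defs where

open import Data.Nat using (ℕ; zero; suc; _+_; _≤_; ∣_-_∣)
open import Data.Fin using (Fin; zero; suc; toℕ; splitAt; opposite; punchIn; punchOut; _≟_)
open import Data.Fin.Subset using (Subset; _∈_; _∩_)
open import Data.List using (List; []; _∷_)
open import Data.List.Relation.Unary.All using (All)
open import Data.Product using (Σ; ∃; _×_; _,_)
open import Data.Sum using (_⊎_; inj₁; inj₂)
open import Relation.Binary.PropositionalEquality using (_≡_; _≢_)
open import Relation.Nullary using (yes; no)

-- Edge-labelled multigraphs in which every vertex meets at most one
-- edge of each label, on a vertex type V with labels Fin r (labels are
-- ordered as in Fin r).  Such a graph is given by, for each label l,
-- the map  σ l : V → V  sending a vertex to the other end of its
-- l-edge, and fixing it when it has no l-edge.  This map is exactly the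
-- involution ρ_l = product of the transpositions (a b) over the edges
-- {a,b} of label l.

IsEdge : {V : Set} {r : ℕ} → (Fin r → V → V) → Fin r → V → V → Set
IsEdge σ l a b = (a ≢ b) × (σ l a ≡ b)

IsLabelledGraph : {V : Set} {r : ℕ} → (Fin r → V → V) → Set
IsLabelledGraph {V} {r} σ =
  ((l : Fin r) (x : V) → σ l (σ l x) ≡ x) ×
  ((l : Fin r) → Σ V λ a → Σ V λ b → IsEdge σ l a b)

eval : {V : Set} {r : ℕ} → (Fin r → V → V) → List (Fin r) → V → V
eval ρ []      x = x
eval ρ (i ∷ w) x = ρ i (eval ρ w x)

WordIn : {r : ℕ} → Subset r → List (Fin r) → Set
WordIn I w = All (λ i → i ∈ I) w

-- g belongs to ⟨ ρ_i : i ∈ I ⟩ (the generators being involutions, the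
-- generated subgroup consists of the products of words)
InSubgroup : {V : Set} {r : ℕ} → (Fin r → V → V) → Subset r → (V → V) → Set
InSubgroup ρ I g = Σ (List _) λ w → WordIn I w × ((x : _) → eval ρ w x ≡ g x)

IsSggi : {V : Set} {r : ℕ} → (Fin r → V → V) → Set
IsSggi {V} {r} ρ =
  ((i : Fin r) (x : V) → ρ i (ρ i x) ≡ x) ×
  ((i : Fin r) → Σ V λ x → ρ i x ≢ x) ×
  ((i j : Fin r) → 2 ≤ ∣ toℕ i - toℕ j ∣ → (x : V) → ρ i (ρ j (ρ i (ρ j x))) ≡ x)

-- intersection property (the inclusion ⊇ always holds)
IntersectionProperty : {V : Set} {r : ℕ} → (Fin r → V → V) → Set
IntersectionProperty {V} {r} ρ =
  (I J : Subset r) (g : V → V) →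
  InSubgroup ρ I g → InSubgroup ρ J g → InSubgroup ρ (I ∩ J) g

IsStringCGroup : {V : Set} {r : ℕ} → (Fin r → V → V) → Set
IsStringCGroup ρ = IsSggi ρ × IntersectionProperty ρ

IsCPRGraph : {V : Set} {r : ℕ} → (Fin r → V → V) → Set
IsCPRGraph σ = IsLabelledGraph σ × IsStringCGroup σ

PendantZero : {V : Set} {r : ℕ} → (Fin (suc r) → V → V) → V → Set
PendantZero {V} {r} σ A =
  (σ zero A ≢ A) ×
  ((l : Fin (suc r)) → l ≢ zero → σ l A ≡ A) ×
  ((a b : V) → IsEdge σ zero a b → (a ≡ A) ⊎ (b ≡ A))

-- Vertex set: Ω₁ ⊎ (Ω₂ ∖ {B}), where Ω₂ ∖ {B} is
-- identified with Fin m via punchOut/punchIn; the vertex C is inj₁ A.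
-- Label set: Fin (r + r̃), position k < r standing for the label
-- -r + k, i.e. for the G-label l = r - 1 - k (so -(l+1) = -r + k), and
-- position r + l standing for the G̃-label l.

embed₂ : {n₁ m : ℕ} → Fin n₁ → Fin (suc m) → Fin (suc m) → Fin n₁ ⊎ Fin m
embed₂ A B x with B ≟ x
... | yes _  = inj₁ A
... | no B≢x = inj₂ (punchOut B≢x)

glue : {r r̃ n₁ m : ℕ} →
       (Fin r → Fin n₁ → Fin n₁) → (Fin r̃ → Fin (suc m) → Fin (suc m)) →
       Fin n₁ → Fin (suc m) →
       Fin (r + r̃) → Fin n₁ ⊎ Fin m → Fin n₁ ⊎ Fin m
glue {r} σ τ A B k v with splitAt r k
glue σ τ A B k (inj₁ x) | inj₁ l = inj₁ (σ (opposite l) x)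
glue σ τ A B k (inj₂ y) | inj₁ l = inj₂ y
glue σ τ A B k (inj₁ x) | inj₂ l with x ≟ A
... | yes _ = embed₂ A B (τ l B)
... | no _  = inj₁ x
glue σ τ A B k (inj₂ y) | inj₂ l = embed₂ A B (τ l (punchIn B y))

{-# OPTIONS --safe #-}
module Submission where

-- Call c a hub of ρ if every generator either fixes c or is the transposition of c with its image.
-- Then ⟨ρ_K⟩ contains the transposition (c x) for every x in the K-orbit of c, hence the whole symmetric
-- group of that orbit, so an element of ⟨ρ_K⟩ is determined up to that symmetric group by its action
-- off the orbit.  The pendant vertices A, B and the glued vertex C are hubs.  An element g of ⟨I⟩ ∩ ⟨J⟩
-- in the glued group acts on each side, off the orbits of the hub, like an element of the I-part and
-- like an element of the J-part of that side's group; patching the two by the identity on the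
-- intersection of the orbits gives one permutation in both, hence, by the intersection property of the
-- side, in its (I ∩ J)-part.  As the I- and J-orbits of a hub meet in its (I ∩ J)-orbit, the lifts of
-- these side elements agree with g off the (I ∩ J)-orbit of C, so g ∈ ⟨I ∩ J⟩.  The string relations
-- are inherited from each side; across the sides only the labels -1 and 0 are adjacent, and any other
-- pair contains a generator fixing C, so the two involutions have disjoint supports.

open import Data.Fin using (Fin; zero; suc; toℕ; splitAt; opposite; punchIn; _↑ˡ_; _↑ʳ_)
import Data.Fin
open import Data.Fin.Properties
  using (any?; toℕ-↑ˡ; toℕ-↑ʳ; toℕ≤pred[n]; opposite-prop; opposite-involutive; splitAt-↑ˡ; splitAt-↑ʳ;
         splitAt⁻¹-↑ˡ; splitAt⁻¹-↑ʳ; punchInᵢ≢i; punchOut-cong; punchOut-punchIn; punchOut-injective;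
         punchIn-punchOut)
open import Data.Fin.Subset using (Subset; _∈_; _∩_; _∪_; _⊆_; ⁅_⁆; ∣_∣)
open import Data.Fin.Subset.Properties
  using (_∈?_; _⊂?_; x∈p∪q⁺; x∈p∪q⁻; p⊆p∪q; x∈⁅x⁆; x∈⁅y⁆⇒x≡y; ∣⁅x⁆∣≡1; ∣p∣≤n; p⊂q⇒∣p∣<∣q∣; ⊆-antisym)
open import Data.List using (List; []; _∷_; _++_; allFin)
import Data.List
open import Data.List.Membership.Propositional using () renaming (_∈_ to _∈ˡ_)
open import Data.List.Membership.Propositional.Properties using (∈-allFin; ∈-map⁺; ∈-++⁺ˡ; ∈-++⁺ʳ)
open import Data.List.Relation.Unary.All using ([]; _∷_)
open import Data.List.Relation.Unary.All.Properties using (++⁺)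
open import Data.List.Relation.Unary.Any using (here; there)
open import Data.Nat using (ℕ; zero; suc; _+_; _∸_; _<_; _≤_; ∣_-_∣; s≤s; z≤n)
open import Data.Nat.Properties
  using (+-suc; ≤-trans; <-irrefl; n≤1+n; m∸n≤m; m∸[m∸n]≡n; ∣n-n∣≡0; m≤n⇒∣n-m∣≡n∸m; m≤n⇒∣m-n∣≡n∸m;
         ∣m+n-m+o∣≡∣n-o∣; ∣m-m+n∣≡n; ∣-∣-comm)
open import Data.Product using (Σ; ∃; _×_; _,_; proj₁; proj₂; uncurry)
open import Data.Sum using (_⊎_; inj₁; inj₂)
import Data.Sum
open import Data.Sum.Properties using (inj₁-injective; inj₂-injective; ≡-dec)
open import Data.Vec using (tabulate; lookup)
import Data.Vec as Vec
open import Data.Vec.Properties using ([]=⇒lookup; lookup⇒[]=; lookup∘tabulate; lookup-zipWith)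
open import Function using (_∘_; id)
open import Function.Definitions using (Injective)
open import Level using (0ℓ)
open import Relation.Binary.Definitions using (DecidableEquality)
open import Relation.Binary.PropositionalEquality
open import Relation.Nullary using (¬_; Dec; yes; no; does; contradiction)
open import Relation.Nullary.Decidable using (_×-dec_; dec-true)
open import Relation.Unary using (Pred; Decidable)

open import Defs

InOrbit : {V : Set} {k : ℕ} → (Fin k → V → V) → Subset k → V → V → Set
InOrbit ρ K c z = Σ (List _) λ w → WordIn K w × eval ρ w c ≡ z

FixesOrTransposes : {V : Set} {k : ℕ} → (Fin k → V → V) → V → Set
FixesOrTransposes ρ c = ∀ i → ρ i c ≡ c ⊎ (∀ z → z ≢ c → z ≢ ρ i c → ρ i z ≡ z)

preimage : {a b : ℕ} → (Fin a → Fin b) → Subset b → Subset a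
preimage f K = tabulate (lookup K ∘ f)

∈-preimage⁺ : ∀ {a b} (f : Fin a → Fin b) {K l} → f l ∈ K → l ∈ preimage f K
∈-preimage⁺ f {K} {l} fl∈K =
  lookup⇒[]= l _ (trans (lookup∘tabulate (lookup K ∘ f) l) ([]=⇒lookup fl∈K))

∈-preimage⁻ : ∀ {a b} (f : Fin a → Fin b) {K l} → l ∈ preimage f K → f l ∈ K
∈-preimage⁻ f {K} {l} l∈ =
  lookup⇒[]= (f l) K (trans (sym (lookup∘tabulate (lookup K ∘ f) l)) ([]=⇒lookup l∈))

preimage-∩ : ∀ {a b} (f : Fin a → Fin b) I J → preimage f (I ∩ J) ≡ preimage f I ∩ preimage f J
preimage-∩ {zero}  f I J = refl
preimage-∩ {suc a} f I J = cong₂ Vec._∷_ (lookup-zipWith _ (f zero) I J) (preimage-∩ (f ∘ suc) I J)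

module Transposition {V : Set} (_≟_ : DecidableEquality V) where

  transpose : V → V → V → V
  transpose a b z = choose (z ≟ a) (z ≟ b)
    where
    choose : Dec (z ≡ a) → Dec (z ≡ b) → V
    choose (yes _) _       = b
    choose (no _)  (yes _) = a
    choose (no _)  (no _)  = z

  transpose-≡ˡ : ∀ a b → transpose a b a ≡ b
  transpose-≡ˡ a b with a ≟ a
  ... | yes _  = refl
  ... | no a≢a = contradiction refl a≢a

  transpose-≡ʳ : ∀ a b → transpose a b b ≡ a
  transpose-≡ʳ a b with b ≟ a | b ≟ b
  ... | yes b≡a | _      = b≡a
  ... | no _    | yes _  = refl
  ... | no _    | no b≢b = contradiction refl b≢b

  transpose-≢ : ∀ {a b z} → z ≢ a → z ≢ b → transpose a b z ≡ z
  transpose-≢ {a} {b} {z} z≢a z≢b with z ≟ a | z ≟ b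
  ... | yes z≡a | _       = contradiction z≡a z≢a
  ... | no _    | yes z≡b = contradiction z≡b z≢b
  ... | no _    | no _    = refl

  transpose-involutive : ∀ a b z → transpose a b (transpose a b z) ≡ z
  transpose-involutive a b z with z ≟ a | z ≟ b
  ... | yes refl | _        = transpose-≡ʳ z b
  ... | no _     | yes refl = transpose-≡ˡ a z
  ... | no z≢a   | no z≢b   = transpose-≢ z≢a z≢b

  transpose-injective : ∀ a b → Injective _≡_ _≡_ (transpose a b)
  transpose-injective a b {x} {y} e =
    trans (sym (transpose-involutive a b x)) (trans (cong (transpose a b) e) (transpose-involutive a b y))

  transpose-self : ∀ a z → transpose a a z ≡ z
  transpose-self a z with z ≟ a
  ... | yes z≡a = sym z≡a
  ... | no _    = refl

  transpose-comm : ∀ a b z → transpose a b z ≡ transpose b a z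
  transpose-comm a b z with z ≟ a | z ≟ b
  ... | yes z≡a | yes z≡b = trans (sym z≡b) z≡a
  ... | yes _   | no _    = refl
  ... | no _    | yes _   = refl
  ... | no _    | no _    = refl

  transpose-conj : (f : V → V) → (∀ x → f (f x) ≡ x) →
                   ∀ a b z → f (transpose a b (f z)) ≡ transpose (f a) (f b) z
  transpose-conj f f-inv a b z with z ≟ f a | z ≟ f b
  ... | yes refl | _        = trans (cong (f ∘ transpose a b) (f-inv a)) (cong f (transpose-≡ˡ a b))
  ... | no _     | yes refl = trans (cong (f ∘ transpose a b) (f-inv b)) (cong f (transpose-≡ʳ a b))
  ... | no z≢fa  | no z≢fb  =
    trans (cong f (transpose-≢ (z≢fa ∘ f-moved) (z≢fb ∘ f-moved))) (f-inv z)
    where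
    f-moved : ∀ {x} → f z ≡ x → z ≡ f x
    f-moved fz≡x = trans (sym (f-inv z)) (cong f fz≡x)

  involution≗transpose : (f : V → V) → (∀ x → f (f x) ≡ x) → ∀ c →
                         (∀ z → z ≢ c → z ≢ f c → f z ≡ z) → ∀ z → f z ≡ transpose c (f c) z
  involution≗transpose f f-inv c fixes z with z ≟ c | z ≟ f c
  ... | yes refl | _        = refl
  ... | no _     | yes refl = f-inv c
  ... | no z≢c   | no z≢fc  = fixes z z≢c z≢fc

module Generation {V : Set} {k : ℕ} (ρ : Fin k → V → V) (ρ-involutive : ∀ i x → ρ i (ρ i x) ≡ x) where

  eval-++ : ∀ u w x → eval ρ (u ++ w) x ≡ eval ρ u (eval ρ w x)
  eval-++ []      w x = refl
  eval-++ (i ∷ u) w x = cong (ρ i) (eval-++ u w x)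

  generator-injective : ∀ i → Injective _≡_ _≡_ (ρ i)
  generator-injective i {x} {y} e = trans (sym (ρ-involutive i x)) (trans (cong (ρ i) e) (ρ-involutive i y))

  eval-injective : ∀ w → Injective _≡_ _≡_ (eval ρ w)
  eval-injective []      e = e
  eval-injective (i ∷ w) e = eval-injective w (generator-injective i e)

  module _ {K : Subset k} where

    InSubgroup-injective : ∀ {g} → InSubgroup ρ K g → Injective _≡_ _≡_ g
    InSubgroup-injective (w , _ , w≗g) e = eval-injective w (trans (w≗g _) (trans e (sym (w≗g _))))

    InSubgroup-resp-≗ : ∀ {f g} → f ≗ g → InSubgroup ρ K f → InSubgroup ρ K g
    InSubgroup-resp-≗ f≗g (w , w∈K , w≗f) = w , w∈K , λ x → trans (w≗f x) (f≗g x)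

    InSubgroup-id : InSubgroup ρ K id
    InSubgroup-id = [] , [] , λ _ → refl

    InSubgroup-generator : ∀ {i} → i ∈ K → InSubgroup ρ K (ρ i)
    InSubgroup-generator {i} i∈K = i ∷ [] , i∈K ∷ [] , λ _ → refl

    InSubgroup-∘ : ∀ {f g} → InSubgroup ρ K f → InSubgroup ρ K g → InSubgroup ρ K (f ∘ g)
    InSubgroup-∘ (u , u∈K , u≗f) (w , w∈K , w≗g) =
      u ++ w , ++⁺ u∈K w∈K , λ x → trans (eval-++ u w x) (trans (cong (eval ρ u) (w≗g x)) (u≗f _))

    InOrbit-refl : ∀ {c} → InOrbit ρ K c c
    InOrbit-refl = [] , [] , refl

    InOrbit-generator : ∀ {c z i} → i ∈ K → InOrbit ρ K c z → InOrbit ρ K c (ρ i z)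
    InOrbit-generator i∈K (w , w∈K , refl) = _ ∷ w , i∈K ∷ w∈K , refl

    InOrbit-eval⁻ : ∀ {c x} w → WordIn K w → InOrbit ρ K c (eval ρ w x) → InOrbit ρ K c x
    InOrbit-eval⁻ []      []          o = o
    InOrbit-eval⁻ (i ∷ w) (i∈K ∷ w∈K) o =
      InOrbit-eval⁻ w w∈K (subst (InOrbit ρ K _) (ρ-involutive i _) (InOrbit-generator i∈K o))

    ∉Orbit⇒≢ : ∀ {c x} → ¬ InOrbit ρ K c x → x ≢ c
    ∉Orbit⇒≢ x∉ refl = x∉ InOrbit-refl

    ∉Orbit-InSubgroup : ∀ {c x g} → InSubgroup ρ K g → ¬ InOrbit ρ K c x → ¬ InOrbit ρ K c (g x)
    ∉Orbit-InSubgroup (w , w∈K , w≗g) x∉ o =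
      x∉ (InOrbit-eval⁻ w w∈K (subst (InOrbit ρ K _) (sym (w≗g _)) o))

module Hub {V : Set} (_≟_ : DecidableEquality V) {k : ℕ} (ρ : Fin k → V → V)
           (ρ-involutive : ∀ i x → ρ i (ρ i x) ≡ x) (c : V) (hub : FixesOrTransposes ρ c) where

  open Transposition _≟_
  open Generation ρ ρ-involutive

  module _ {K : Subset k} where

    transpose-hub-InSubgroup : ∀ {x} → InOrbit ρ K c x → InSubgroup ρ K (transpose c x)
    transpose-hub-InSubgroup (w , w∈K , refl) = along w w∈K
      where
      along : ∀ w → WordIn K w → InSubgroup ρ K (transpose c (eval ρ w c))
      along []      []          = InSubgroup-resp-≗ (sym ∘ transpose-self c) InSubgroup-id
      along (i ∷ w) (i∈K ∷ w∈K) with hub i | eval ρ w c ≟ c | eval ρ w c ≟ ρ i c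
      ... | inj₁ ρc≡c | _ | _ =
        InSubgroup-resp-≗ conjugate
          (InSubgroup-∘ (InSubgroup-generator i∈K) (InSubgroup-∘ (along w w∈K) (InSubgroup-generator i∈K)))
        where
        conjugate : ∀ z → ρ i (transpose c (eval ρ w c) (ρ i z)) ≡ transpose c (ρ i (eval ρ w c)) z
        conjugate z = trans (transpose-conj (ρ i) (ρ-involutive i) c _ z)
                            (cong (λ a → transpose a (ρ i (eval ρ w c)) z) ρc≡c)
      ... | inj₂ fixes | yes y≡c | _ =
        InSubgroup-resp-≗ (λ z → trans (involution≗transpose (ρ i) (ρ-involutive i) c fixes z)
                                        (cong (λ a → transpose c (ρ i a) z) (sym y≡c)))
                          (InSubgroup-generator i∈K)
      ... | inj₂ _ | no _ | yes y≡ρc =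
        InSubgroup-resp-≗ (λ z → trans (sym (transpose-self c z))
                                        (cong (λ a → transpose c a z) (sym (trans (cong (ρ i) y≡ρc) (ρ-involutive i c)))))
                          InSubgroup-id
      ... | inj₂ fixes | no y≢c | no y≢ρc =
        subst (InSubgroup ρ K ∘ transpose c) (sym (fixes _ y≢c y≢ρc)) (along w w∈K)

    transpose-InSubgroup : ∀ {x y} → InOrbit ρ K c x → InOrbit ρ K c y → x ≢ y → InSubgroup ρ K (transpose x y)
    transpose-InSubgroup {x} {y} ox oy x≢y with y ≟ c
    ... | yes refl = InSubgroup-resp-≗ (transpose-comm c x) (transpose-hub-InSubgroup ox)
    ... | no y≢c =
      InSubgroup-resp-≗ conjugate
        (InSubgroup-∘ (transpose-hub-InSubgroup ox)
          (InSubgroup-∘ (transpose-hub-InSubgroup oy) (transpose-hub-InSubgroup ox)))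
      where
      conjugate : ∀ z → transpose c x (transpose c y (transpose c x z)) ≡ transpose x y z
      conjugate z = trans (transpose-conj (transpose c x) (transpose-involutive c x) c y z)
                          (cong₂ (λ a b → transpose a b z) (transpose-≡ˡ c x) (transpose-≢ y≢c (x≢y ∘ sym)))

    supported⇒InSubgroup : ∀ xs {π} → Injective _≡_ _≡_ π →
                           (∀ z → π z ≡ z ⊎ (z ∈ˡ xs × InOrbit ρ K c z)) → InSubgroup ρ K π
    supported⇒InSubgroup [] {π} _ supp = InSubgroup-resp-≗ (λ z → fixed z (supp z)) InSubgroup-id
      where
      fixed : ∀ z → π z ≡ z ⊎ (z ∈ˡ [] × InOrbit ρ K c z) → z ≡ π z
      fixed z (inj₁ πz≡z) = sym πz≡z
    supported⇒InSubgroup (x ∷ xs) {π} π-inj supp with π x ≟ x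
    ... | yes πx≡x = supported⇒InSubgroup xs π-inj supp′
      where
      supp′ : ∀ z → π z ≡ z ⊎ (z ∈ˡ xs × InOrbit ρ K c z)
      supp′ z with supp z
      ... | inj₁ πz≡z             = inj₁ πz≡z
      ... | inj₂ (here refl , _)  = inj₁ πx≡x
      ... | inj₂ (there z∈xs , o) = inj₂ (z∈xs , o)
    ... | no πx≢x =
      InSubgroup-resp-≗ (λ z → transpose-involutive x (π x) (π z))
        (InSubgroup-∘ (transpose-InSubgroup ox oπx (πx≢x ∘ sym)) (supported⇒InSubgroup xs (π-inj ∘ transpose-injective x (π x)) supp′))
      where
      π′ : V → V
      π′ = transpose x (π x) ∘ π
      ox : InOrbit ρ K c x
      ox with supp x
      ... | inj₁ πx≡x  = contradiction πx≡x πx≢x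
      ... | inj₂ (_ , o) = o
      oπx : InOrbit ρ K c (π x)
      oπx with supp (π x)
      ... | inj₁ ππx≡πx = contradiction (π-inj ππx≡πx) πx≢x
      ... | inj₂ (_ , o) = o
      supp′ : ∀ z → π′ z ≡ z ⊎ (z ∈ˡ xs × InOrbit ρ K c z)
      supp′ z with supp z
      ... | inj₁ πz≡z = inj₁ (trans (cong (transpose x (π x)) πz≡z) (transpose-≢ z≢x z≢πx))
        where
        z≢x : z ≢ x
        z≢x z≡x = πx≢x (subst (λ a → π a ≡ a) z≡x πz≡z)
        z≢πx : z ≢ π x
        z≢πx z≡πx = z≢x (π-inj (trans πz≡z z≡πx))
      ... | inj₂ (here refl , _)  = inj₁ (transpose-≡ʳ x (π x))
      ... | inj₂ (there z∈xs , o) = inj₂ (z∈xs , o)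

    agreesOffOrbit⇒InSubgroup : ∀ {xs} → (∀ v → v ∈ˡ xs) → ∀ {f g} → InSubgroup ρ K f → Injective _≡_ _≡_ g →
                                (∀ v → InOrbit ρ K c v ⊎ g v ≡ f v) → InSubgroup ρ K g
    agreesOffOrbit⇒InSubgroup {xs} complete (u , u∈K , u≗f) g-inj agree =
      along u u∈K g-inj (λ v → Data.Sum.map id (λ gv≡fv → trans gv≡fv (sym (u≗f v))) (agree v))
      where
      along : ∀ u → WordIn K u → ∀ {g} → Injective _≡_ _≡_ g →
              (∀ v → InOrbit ρ K c v ⊎ g v ≡ eval ρ u v) → InSubgroup ρ K g
      along [] [] g-inj agree =
        supported⇒InSubgroup xs g-inj λ v → Data.Sum.map id (complete v ,_) (Data.Sum.swap (agree v))
      along (i ∷ u) (i∈K ∷ u∈K) {g} g-inj agree =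
        InSubgroup-resp-≗ (λ v → ρ-involutive i (g v))
          (InSubgroup-∘ (InSubgroup-generator i∈K) (along u u∈K (g-inj ∘ generator-injective i) agree′))
        where
        agree′ : ∀ v → InOrbit ρ K c v ⊎ ρ i (g v) ≡ eval ρ u v
        agree′ v = Data.Sum.map id (λ gv≡ → trans (cong (ρ i) gv≡) (ρ-involutive i _)) (agree v)

  InOrbit-∩ : IntersectionProperty ρ → ∀ {I J x} → InOrbit ρ I c x → InOrbit ρ J c x → InOrbit ρ (I ∩ J) c x
  InOrbit-∩ ip {I} {J} {x} oI oJ
    with ip I J (transpose c x) (transpose-hub-InSubgroup oI) (transpose-hub-InSubgroup oJ)
  ... | w , w∈I∩J , w≗cx = w , w∈I∩J , trans (w≗cx c) (transpose-≡ˡ c x)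

∈-tabulate-does⁺ : ∀ {n} {P : Pred (Fin n) 0ℓ} (P? : Decidable P) {y} → P y → y ∈ tabulate (does ∘ P?)
∈-tabulate-does⁺ P? {y} py = lookup⇒[]= y _ (trans (lookup∘tabulate (does ∘ P?) y) (dec-true (P? y) py))

∈-tabulate-does⁻ : ∀ {n} {P : Pred (Fin n) 0ℓ} (P? : Decidable P) {y} → y ∈ tabulate (does ∘ P?) → P y
∈-tabulate-does⁻ P? {y} y∈ with P? y | trans (sym (lookup∘tabulate (does ∘ P?) y)) ([]=⇒lookup y∈)
... | yes py | _ = py
... | no _   | ()

module OrbitDecidable {n k : ℕ} (ρ : Fin k → Fin n → Fin n) (ρ-involutive : ∀ i x → ρ i (ρ i x) ≡ x)
                      (K : Subset k) (c : Fin n) where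

  open Generation ρ ρ-involutive

  stepsInto : Subset n → Fin n → Set
  stepsInto S y = ∃ λ i → i ∈ K × ρ i y ∈ S

  grow : Subset n → Subset n
  grow S = S ∪ tabulate (does ∘ λ y → any? λ i → (i ∈? K) ×-dec (ρ i y ∈? S))

  ∈-grow⁺ : ∀ {S y} → stepsInto S y → y ∈ grow S
  ∈-grow⁺ steps = x∈p∪q⁺ (inj₂ (∈-tabulate-does⁺ (λ y → any? λ i → (i ∈? K) ×-dec (ρ i y ∈? _)) steps))

  ∈-grow⁻ : ∀ {S y} → y ∈ grow S → y ∈ S ⊎ stepsInto S y
  ∈-grow⁻ {S} y∈ =
    Data.Sum.map id (∈-tabulate-does⁻ (λ y → any? λ i → (i ∈? K) ×-dec (ρ i y ∈? S))) (x∈p∪q⁻ S _ y∈)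

  reach : ℕ → Subset n
  reach zero    = ⁅ c ⁆
  reach (suc t) = grow (reach t)

  reach-sound : ∀ t {y} → y ∈ reach t → InOrbit ρ K c y
  reach-sound zero    y∈ = subst (InOrbit ρ K c) (sym (x∈⁅y⁆⇒x≡y c y∈)) InOrbit-refl
  reach-sound (suc t) y∈ with ∈-grow⁻ y∈
  ... | inj₁ y∈reach = reach-sound t y∈reach
  ... | inj₂ (i , i∈K , ρy∈reach) =
    subst (InOrbit ρ K c) (ρ-involutive i _) (InOrbit-generator i∈K (reach-sound t ρy∈reach))

  reach-grows : ∀ t → grow (reach t) ≡ reach t ⊎ t < ∣ reach t ∣
  reach-grows zero = inj₂ (subst (0 <_) (sym (∣⁅x⁆∣≡1 c)) (s≤s z≤n))
  reach-grows (suc t) with reach-grows t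
  ... | inj₁ fixed = inj₁ (cong grow fixed)
  ... | inj₂ t<∣reach∣ with reach t ⊂? grow (reach t)
  ...   | yes grown = inj₂ (≤-trans (s≤s t<∣reach∣) (p⊂q⇒∣p∣<∣q∣ grown))
  ...   | no ¬grown = inj₁ (cong grow (⊆-antisym shrinks (p⊆p∪q _)))
    where
    shrinks : grow (reach t) ⊆ reach t
    shrinks {y} y∈ with y ∈? reach t
    ... | yes y∈reach = y∈reach
    ... | no y∉reach  = contradiction ((λ {_} → p⊆p∪q _) , y , y∈ , y∉reach) ¬grown

  reach-fixed : grow (reach n) ≡ reach n
  reach-fixed with reach-grows n
  ... | inj₁ fixed   = fixed
  ... | inj₂ n<∣reach∣ = contradiction (≤-trans n<∣reach∣ (∣p∣≤n (reach n))) (<-irrefl refl)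

  reach-complete : ∀ {y} → InOrbit ρ K c y → y ∈ reach n
  reach-complete (w , w∈K , refl) = along w w∈K
    where
    c∈reach : ∀ t → c ∈ reach t
    c∈reach zero    = x∈⁅x⁆ c
    c∈reach (suc t) = p⊆p∪q _ (c∈reach t)
    along : ∀ w → WordIn K w → eval ρ w c ∈ reach n
    along []      []          = c∈reach n
    along (i ∷ w) (i∈K ∷ w∈K) =
      subst (_ ∈_) reach-fixed (∈-grow⁺ (i , i∈K , subst (_∈ reach n) (sym (ρ-involutive i _)) (along w w∈K)))

  InOrbit? : Decidable (InOrbit ρ K c)
  InOrbit? y with y ∈? reach n
  ... | yes y∈ = yes (reach-sound n y∈)
  ... | no y∉  = no (y∉ ∘ reach-complete)

AgreesOffOrbit : {V : Set} {n k : ℕ} → (Fin k → Fin n → Fin n) → Fin n → Subset k → (Fin n → V) → (V → V) → Set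
AgreesOffOrbit {n = n} ρ c K ι g =
  Σ (Fin n → Fin n) λ p → InSubgroup ρ K p × (∀ x → ¬ InOrbit ρ K c x → g (ι x) ≡ ι (p x))

module Restriction {n k : ℕ} (ρ : Fin k → Fin n → Fin n) (ρ-involutive : ∀ i x → ρ i (ρ i x) ≡ x)
                   (ip : IntersectionProperty ρ) (c : Fin n) (hub : FixesOrTransposes ρ c)
                   {V : Set} {ι : Fin n → V} (ι-injective : Injective _≡_ _≡_ ι)
                   {g : V → V} (g-injective : Injective _≡_ _≡_ g) where

  open Generation ρ ρ-involutive
  open Hub Data.Fin._≟_ ρ ρ-involutive c hub

  AgreesOffOrbit-∩ : ∀ {I J} → AgreesOffOrbit ρ c I ι g → AgreesOffOrbit ρ c J ι g →
                     AgreesOffOrbit ρ c (I ∩ J) ι g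
  AgreesOffOrbit-∩ {I} {J} (p , p∈I , g≗p) (q , q∈J , g≗q) =
    π , ip I J π π∈I π∈J , λ x x∉I∩J → proj₁ (outside x (x∉I∩J ∘ uncurry (InOrbit-∩ ip)))
    where
    open OrbitDecidable ρ ρ-involutive I c using () renaming (InOrbit? to InOrbitI?)
    open OrbitDecidable ρ ρ-involutive J c using () renaming (InOrbit? to InOrbitJ?)

    InBoth : Fin n → Set
    InBoth x = InOrbit ρ I c x × InOrbit ρ J c x

    choose : ∀ x → Dec (InOrbit ρ I c x) → Dec (InOrbit ρ J c x) → Fin n
    choose x (yes _) (yes _) = x
    choose x (yes _) (no _)  = q x
    choose x (no _)  _       = p x

    π : Fin n → Fin n
    π x = choose x (InOrbitI? x) (InOrbitJ? x)

    inside : ∀ {x} → InBoth x → π x ≡ x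
    inside {x} (oI , oJ) with InOrbitI? x | InOrbitJ? x
    ... | yes _  | yes _  = refl
    ... | yes _  | no ¬oJ = contradiction oJ ¬oJ
    ... | no ¬oI | _      = contradiction oI ¬oI

    outside : ∀ x → ¬ InBoth x → g (ι x) ≡ ι (π x) × ¬ InBoth (π x)
    outside x ¬both with InOrbitI? x | InOrbitJ? x
    ... | yes oI | yes oJ = contradiction (oI , oJ) ¬both
    ... | yes _  | no ¬oJ = g≗q x ¬oJ , ∉Orbit-InSubgroup q∈J ¬oJ ∘ proj₂
    ... | no ¬oI | _      = g≗p x ¬oI , ∉Orbit-InSubgroup p∈I ¬oI ∘ proj₁

    both? : ∀ x → Dec (InBoth x)
    both? x = InOrbitI? x ×-dec InOrbitJ? x

    π-injective : Injective _≡_ _≡_ π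
    π-injective {a} {b} e with both? a | both? b
    ... | yes inA | yes inB = trans (sym (inside inA)) (trans e (inside inB))
    ... | yes inA | no ¬inB =
      contradiction (subst InBoth (trans (sym (inside inA)) e) inA) (proj₂ (outside b ¬inB))
    ... | no ¬inA | yes inB =
      contradiction (subst InBoth (trans (sym (inside inB)) (sym e)) inB) (proj₂ (outside a ¬inA))
    ... | no ¬inA | no ¬inB =
      ι-injective (g-injective (trans (proj₁ (outside a ¬inA)) (trans (cong ι e) (sym (proj₁ (outside b ¬inB))))))

    π∈I : InSubgroup ρ I π
    π∈I = agreesOffOrbit⇒InSubgroup ∈-allFin p∈I π-injective agree
      where
      agree : ∀ x → InOrbit ρ I c x ⊎ π x ≡ p x
      agree x with InOrbitI? x | InOrbitJ? x
      ... | yes oI | _ = inj₁ oI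
      ... | no _   | _ = inj₂ refl

    π∈J : InSubgroup ρ J π
    π∈J = agreesOffOrbit⇒InSubgroup ∈-allFin q∈J π-injective agree
      where
      agree : ∀ x → InOrbit ρ J c x ⊎ π x ≡ q x
      agree x with InOrbitI? x | InOrbitJ? x
      ... | _      | yes oJ = inj₁ oJ
      ... | yes _  | no _   = inj₂ refl
      ... | no ¬oI | no ¬oJ = inj₂ (ι-injective (trans (sym (g≗p x ¬oI)) (g≗q x ¬oJ)))

record IsBranch {V : Set} {N k n : ℕ} (h : Fin N → V → V) (C : V)
                (ρ : Fin k → Fin n → Fin n) (c : Fin n) (ι : Fin n → V) (lift : Fin k → Fin N) : Set where
  field
    ι-injective : Injective _≡_ _≡_ ι
    ι-hub       : ι c ≡ C
    h-lift      : ∀ l x → h (lift l) (ι x) ≡ ι (ρ l x)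
    h-other     : ∀ j → (∀ l → lift l ≢ j) → ∀ x → x ≢ c → h j (ι x) ≡ ι x

module Branch {V : Set} {N k n : ℕ} {h : Fin N → V → V} {C : V} {ρ : Fin k → Fin n → Fin n} {c : Fin n}
              {ι : Fin n → V} {lift : Fin k → Fin N} (b : IsBranch h C ρ c ι lift) where

  open IsBranch b

  eval-lift : ∀ u x → eval h (Data.List.map lift u) (ι x) ≡ ι (eval ρ u x)
  eval-lift []      x = refl
  eval-lift (l ∷ u) x = trans (cong (h (lift l)) (eval-lift u x)) (h-lift l _)

  lift-WordIn : ∀ {K u} → WordIn (preimage lift K) u → WordIn K (Data.List.map lift u)
  lift-WordIn []          = []
  lift-WordIn (l∈ ∷ u∈) = ∈-preimage⁻ lift l∈ ∷ lift-WordIn u∈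

  lift-InOrbit : ∀ {K x} → InOrbit ρ (preimage lift K) c x → InOrbit h K C (ι x)
  lift-InOrbit (u , u∈ , refl) =
    Data.List.map lift u , lift-WordIn u∈ , trans (cong (eval h (Data.List.map lift u)) (sym ι-hub)) (eval-lift u c)

  lift-edge : ∀ {l x y} → IsEdge ρ l x y → IsEdge h (lift l) (ι x) (ι y)
  lift-edge {l} {x} (x≢y , ρx≡y) = x≢y ∘ ι-injective , trans (h-lift l x) (cong ι ρx≡y)

  lift-moves : ∀ {l x} → ρ l x ≢ x → h (lift l) (ι x) ≢ ι x
  lift-moves {l} {x} moved = moved ∘ ι-injective ∘ trans (sym (h-lift l x))

  restrict : (∀ i x → ρ i (ρ i x) ≡ x) → ∀ {K g} → InSubgroup h K g → AgreesOffOrbit ρ c (preimage lift K) ι g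
  restrict ρ-involutive {K} (w , w∈K , w≗g) =
    eval ρ (project w) , (project w , project-WordIn w∈K , λ _ → refl) ,
    λ x x∉ → trans (sym (w≗g (ι x))) (eval-project w∈K x∉)
    where
    open Generation ρ ρ-involutive

    project : List (Fin N) → List (Fin k)
    project []      = []
    project (j ∷ w) with any? (λ l → lift l Data.Fin.≟ j)
    ... | yes (l , _) = l ∷ project w
    ... | no _        = project w

    project-WordIn : ∀ {w} → WordIn K w → WordIn (preimage lift K) (project w)
    project-WordIn {[]}    []          = []
    project-WordIn {j ∷ w} (j∈K ∷ w∈K) with any? (λ l → lift l Data.Fin.≟ j)
    ... | yes (l , refl) = ∈-preimage⁺ lift j∈K ∷ project-WordIn w∈K
    ... | no _           = project-WordIn w∈K

    eval-project : ∀ {w x} → WordIn K w → ¬ InOrbit ρ (preimage lift K) c x →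
                   eval h w (ι x) ≡ ι (eval ρ (project w) x)
    eval-project {[]}        []          x∉ = refl
    eval-project {j ∷ w} {x} (_ ∷ w∈K) x∉ with any? (λ l → lift l Data.Fin.≟ j)
    ... | yes (l , refl) = trans (cong (h (lift l)) (eval-project w∈K x∉)) (h-lift l _)
    ... | no ¬lift       = trans (cong (h j) (eval-project w∈K x∉))
                                 (h-other j (λ l → ¬lift ∘ (l ,_)) _ (∉Orbit⇒≢ (∉Orbit-InSubgroup w′∈ x∉)))
      where
      w′∈ : InSubgroup ρ (preimage lift K) (eval ρ (project w))
      w′∈ = project w , project-WordIn w∈K , λ _ → refl

  restrict-∩ : (ρ-involutive : ∀ i x → ρ i (ρ i x) ≡ x) → IntersectionProperty ρ → FixesOrTransposes ρ c →
               ∀ {I J g} → Injective _≡_ _≡_ g → InSubgroup h I g → InSubgroup h J g →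
               AgreesOffOrbit ρ c (preimage lift (I ∩ J)) ι g
  restrict-∩ ρ-involutive ip hub {I} {J} {g} g-injective g∈I g∈J =
    subst (λ K → AgreesOffOrbit ρ c K ι g) (sym (preimage-∩ lift I J))
      (AgreesOffOrbit-∩ (restrict ρ-involutive g∈I) (restrict ρ-involutive g∈J))
    where open Restriction ρ ρ-involutive ip c hub ι-injective g-injective

module BranchPair {V : Set} {N : ℕ} {h : Fin N → V → V} {C : V}
  {k n : ℕ} {ρ : Fin k → Fin n → Fin n} {c : Fin n} {ι : Fin n → V} {lift : Fin k → Fin N}
  (b : IsBranch h C ρ c ι lift)
  {k′ n′ : ℕ} {ρ′ : Fin k′ → Fin n′ → Fin n′} {c′ : Fin n′} {ι′ : Fin n′ → V} {lift′ : Fin k′ → Fin N}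
  (b′ : IsBranch h C ρ′ c′ ι′ lift′)
  (lifts-disjoint : ∀ l l′ → lift l ≢ lift′ l′)
  (cover : ∀ v → (∃ λ x → ι x ≡ v) ⊎ (∃ λ z → ι′ z ≡ v)) where

  open IsBranch b
  open IsBranch b′ using () renaming (ι-hub to ι′-hub; h-other to h′-other)
  open Branch b

  eval-lift-other : ∀ u {z} → z ≢ c′ → eval h (Data.List.map lift u) (ι′ z) ≡ ι′ z
  eval-lift-other []      z≢c′ = refl
  eval-lift-other (l ∷ u) z≢c′ =
    trans (cong (h (lift l)) (eval-lift-other u z≢c′)) (h′-other (lift l) (λ l′ → lifts-disjoint l l′ ∘ sym) _ z≢c′)

  hub-on-both-sides : ∀ {z} → z ≡ c′ → ι′ z ≡ ι c
  hub-on-both-sides refl = trans ι′-hub (sym ι-hub)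

  lift-relation : ∀ u → (∀ x → eval ρ u x ≡ x) → ∀ v → eval h (Data.List.map lift u) v ≡ v
  lift-relation u u≗id v with cover v
  ... | inj₁ (x , refl) = trans (eval-lift u x) (cong ι (u≗id x))
  ... | inj₂ (z , refl) with z Data.Fin.≟ c′
  ...   | yes z≡c′ = subst (λ v → eval h (Data.List.map lift u) v ≡ v) (sym (hub-on-both-sides z≡c′))
                           (trans (eval-lift u c) (cong ι (u≗id c)))
  ...   | no z≢c′  = eval-lift-other u z≢c′

  lift-FixesOrTransposes : ∀ l → ρ l c ≡ c ⊎ (∀ x → x ≢ c → x ≢ ρ l c → ρ l x ≡ x) →
                           h (lift l) C ≡ C ⊎ (∀ v → v ≢ C → v ≢ h (lift l) C → h (lift l) v ≡ v)
  lift-FixesOrTransposes l (inj₁ ρc≡c) = inj₁ (trans hC≡ (trans (cong ι ρc≡c) ι-hub))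
    where
    hC≡ : h (lift l) C ≡ ι (ρ l c)
    hC≡ = trans (cong (h (lift l)) (sym ι-hub)) (h-lift l c)
  lift-FixesOrTransposes l (inj₂ fixes) = inj₂ fixed
    where
    hC≡ : h (lift l) C ≡ ι (ρ l c)
    hC≡ = trans (cong (h (lift l)) (sym ι-hub)) (h-lift l c)
    fixed : ∀ v → v ≢ C → v ≢ h (lift l) C → h (lift l) v ≡ v
    fixed v v≢C v≢hC with cover v
    ... | inj₁ (x , refl) = trans (h-lift l x) (cong ι (fixes x (v≢C ∘ λ x≡c → trans (cong ι x≡c) ι-hub)
                                                              (v≢hC ∘ λ x≡ρc → trans (cong ι x≡ρc) (sym hC≡))))
    ... | inj₂ (z , refl) = eval-lift-other (l ∷ []) (v≢C ∘ λ z≡c′ → trans (hub-on-both-sides z≡c′) ι-hub)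

  supports-disjoint : ∀ {l} → ρ l c ≡ c → ∀ l′ v → h (lift l) v ≡ v ⊎ h (lift′ l′) v ≡ v
  supports-disjoint {l} ρc≡c l′ v with cover v
  ... | inj₁ (x , refl) with x Data.Fin.≟ c
  ...   | yes refl = inj₁ (trans (h-lift l x) (cong ι ρc≡c))
  ...   | no x≢c   = inj₂ (h-other (lift′ l′) (λ l″ → lifts-disjoint l″ l′) x x≢c)
  supports-disjoint {l} ρc≡c l′ v | inj₂ (z , refl) with z Data.Fin.≟ c′
  ...   | yes z≡c′ = inj₁ (subst (λ v → h (lift l) v ≡ v) (sym (hub-on-both-sides z≡c′))
                                (trans (h-lift l c) (cong ι ρc≡c)))
  ...   | no z≢c′  = inj₁ (eval-lift-other (l ∷ []) z≢c′)


∣m∸n-m∸o∣≡∣n-o∣ : ∀ {m n o} → n ≤ m → o ≤ m → ∣ m ∸ n - m ∸ o ∣ ≡ ∣ n - o ∣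
∣m∸n-m∸o∣≡∣n-o∣ {m}     {zero}  {zero}  _         _         = ∣n-n∣≡0 m
∣m∸n-m∸o∣≡∣n-o∣ {suc m} {suc n} {suc o} (s≤s n≤m) (s≤s o≤m) = ∣m∸n-m∸o∣≡∣n-o∣ n≤m o≤m
∣m∸n-m∸o∣≡∣n-o∣ {suc m} {zero}  {suc o} _         (s≤s o≤m) =
  trans (m≤n⇒∣n-m∣≡n∸m (≤-trans (m∸n≤m m o) (n≤1+n m))) (m∸[m∸n]≡n (s≤s o≤m))
∣m∸n-m∸o∣≡∣n-o∣ {suc m} {suc n} {zero}  (s≤s n≤m) _         =
  trans (m≤n⇒∣m-n∣≡n∸m (≤-trans (m∸n≤m m n) (n≤1+n m))) (m∸[m∸n]≡n (s≤s n≤m))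

disjoint-involutions⇒fgfg≡id : ∀ {V : Set} {f g : V → V} → (∀ v → f (f v) ≡ v) → (∀ v → g (g v) ≡ v) →
                               (∀ v → f v ≡ v ⊎ g v ≡ v) → ∀ v → f (g (f (g v))) ≡ v
disjoint-involutions⇒fgfg≡id {f = f} {g} f-inv g-inv disjoint v with disjoint v
... | inj₁ fv≡v with disjoint (g v)
...   | inj₁ fgv≡gv = trans (cong (f ∘ g) fgv≡gv) (trans (cong f (g-inv v)) fv≡v)
...   | inj₂ ggv≡gv = trans (cong (f ∘ g ∘ f) gv≡v) (trans (cong (f ∘ g) fv≡v) (trans (cong f gv≡v) fv≡v))
  where
  gv≡v : g v ≡ v
  gv≡v = trans (sym (g-inv (g v))) (trans (cong g ggv≡gv) (g-inv v))
disjoint-involutions⇒fgfg≡id {f = f} {g} f-inv g-inv disjoint v | inj₂ gv≡v with disjoint (f v)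
...   | inj₂ gfv≡fv = trans (cong (f ∘ g ∘ f) gv≡v) (trans (cong f gfv≡fv) (f-inv v))
...   | inj₁ ffv≡fv = trans (cong (f ∘ g ∘ f) gv≡v) (trans (cong (f ∘ g) fv≡v) (trans (cong f gv≡v) fv≡v))
  where
  fv≡v : f v ≡ v
  fv≡v = trans (sym (f-inv (f v))) (trans (cong f ffv≡fv) (f-inv v))

pendant⇒FixesOrTransposes : ∀ {n r} {σ : Fin (suc r) → Fin n → Fin n} {A} → (∀ i x → σ i (σ i x) ≡ x) →
                            PendantZero σ A → FixesOrTransposes σ A
pendant⇒FixesOrTransposes {σ = σ} {A} σ-involutive (_ , others-fix , only-edge) zero = inj₂ fixes
  where
  fixes : ∀ x → x ≢ A → x ≢ σ zero A → σ zero x ≡ x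
  fixes x x≢A x≢σA with σ zero x Data.Fin.≟ x
  ... | yes σx≡x = σx≡x
  ... | no σx≢x with only-edge x (σ zero x) (σx≢x ∘ sym , refl)
  ...   | inj₁ x≡A  = contradiction x≡A x≢A
  ...   | inj₂ σx≡A = contradiction (trans (sym (σ-involutive zero x)) (cong (σ zero) σx≡A)) x≢σA
pendant⇒FixesOrTransposes _ (_ , others-fix , _) (suc i) = inj₁ (others-fix (suc i) λ ())

module Glued {r r̃ n₁ m : ℕ} (σ : Fin (suc r) → Fin n₁ → Fin n₁) (τ : Fin (suc r̃) → Fin (suc m) → Fin (suc m))
             (A : Fin n₁) (B : Fin (suc m)) where

  V : Set
  V = Fin n₁ ⊎ Fin m

  h : Fin (suc r + suc r̃) → V → V
  h = glue σ τ A B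

  C : V
  C = inj₁ A

  ι₂ : Fin (suc m) → V
  ι₂ = embed₂ A B

  lift₁ : Fin (suc r) → Fin (suc r + suc r̃)
  lift₁ l = opposite l ↑ˡ suc r̃

  lift₂ : Fin (suc r̃) → Fin (suc r + suc r̃)
  lift₂ l = suc r ↑ʳ l

  label-cover : ∀ j → (∃ λ l → lift₁ l ≡ j) ⊎ (∃ λ l → lift₂ l ≡ j)
  label-cover j with splitAt (suc r) j in eq
  ... | inj₁ l = inj₁ (opposite l , trans (cong (_↑ˡ suc r̃) (opposite-involutive l)) (splitAt⁻¹-↑ˡ eq))
  ... | inj₂ l = inj₂ (l , splitAt⁻¹-↑ʳ eq)

  lifts-disjoint : ∀ l l′ → lift₁ l ≢ lift₂ l′
  lifts-disjoint l l′ e with trans (sym (splitAt-↑ˡ (suc r) (opposite l) (suc r̃)))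
                                  (trans (cong (splitAt (suc r)) e) (splitAt-↑ʳ (suc r) (suc r̃) l′))
  ... | ()

  ι₂-hub : ι₂ B ≡ C
  ι₂-hub with B Data.Fin.≟ B
  ... | yes _  = refl
  ... | no B≢B = contradiction refl B≢B

  ι₂-punchIn : ∀ y → ι₂ (punchIn B y) ≡ inj₂ y
  ι₂-punchIn y with B Data.Fin.≟ punchIn B y
  ... | yes B≡ = contradiction (sym B≡) (punchInᵢ≢i B y)
  ... | no _   = cong inj₂ (trans (punchOut-cong B refl) (punchOut-punchIn B))

  ι₂-injective : Injective _≡_ _≡_ ι₂
  ι₂-injective {z} {z′} e with B Data.Fin.≟ z | B Data.Fin.≟ z′
  ... | yes B≡z | yes B≡z′ = trans (sym B≡z) B≡z′
  ... | no B≢z  | no B≢z′  = punchOut-injective B≢z B≢z′ (inj₂-injective e)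

  vertex-cover : ∀ v → (∃ λ x → inj₁ x ≡ v) ⊎ (∃ λ z → ι₂ z ≡ v)
  vertex-cover (inj₁ x) = inj₁ (x , refl)
  vertex-cover (inj₂ y) = inj₂ (punchIn B y , ι₂-punchIn y)

  enumeration : List V
  enumeration = Data.List.map inj₁ (allFin n₁) ++ Data.List.map inj₂ (allFin m)

  ∈-enumeration : ∀ v → v ∈ˡ enumeration
  ∈-enumeration (inj₁ x) = ∈-++⁺ˡ (∈-map⁺ inj₁ (∈-allFin x))
  ∈-enumeration (inj₂ y) = ∈-++⁺ʳ _ (∈-map⁺ inj₂ (∈-allFin y))

  h-lift₁-inj₁ : ∀ l x → h (lift₁ l) (inj₁ x) ≡ inj₁ (σ l x)
  h-lift₁-inj₁ l x rewrite splitAt-↑ˡ (suc r) (opposite l) (suc r̃) | opposite-involutive l = refl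

  h-lift₁-inj₂ : ∀ l y → h (lift₁ l) (inj₂ y) ≡ inj₂ y
  h-lift₁-inj₂ l y rewrite splitAt-↑ˡ (suc r) (opposite l) (suc r̃) = refl

  h-lift₂-inj₁ : ∀ l x → x ≢ A → h (lift₂ l) (inj₁ x) ≡ inj₁ x
  h-lift₂-inj₁ l x x≢A rewrite splitAt-↑ʳ (suc r) (suc r̃) l with x Data.Fin.≟ A
  ... | yes x≡A = contradiction x≡A x≢A
  ... | no _    = refl

  h-lift₂-ι₂ : ∀ l z → h (lift₂ l) (ι₂ z) ≡ ι₂ (τ l z)
  h-lift₂-ι₂ l z with B Data.Fin.≟ z
  ... | yes refl rewrite splitAt-↑ʳ (suc r) (suc r̃) l with A Data.Fin.≟ A
  ...   | yes _  = refl
  ...   | no A≢A = contradiction refl A≢A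
  h-lift₂-ι₂ l z | no B≢z rewrite splitAt-↑ʳ (suc r) (suc r̃) l = cong (ι₂ ∘ τ l) (punchIn-punchOut B≢z)

  branch₁ : IsBranch h C σ A inj₁ lift₁
  branch₁ = record
    { ι-injective = inj₁-injective
    ; ι-hub       = refl
    ; h-lift      = h-lift₁-inj₁
    ; h-other     = other
    }
    where
    other : ∀ j → (∀ l → lift₁ l ≢ j) → ∀ x → x ≢ A → h j (inj₁ x) ≡ inj₁ x
    other j not-lift₁ x x≢A with label-cover j
    ... | inj₁ (l , lift₁l≡j) = contradiction lift₁l≡j (not-lift₁ l)
    ... | inj₂ (l , refl)     = h-lift₂-inj₁ l x x≢A

  branch₂ : IsBranch h C τ B ι₂ lift₂
  branch₂ = record
    { ι-injective = ι₂-injective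
    ; ι-hub       = ι₂-hub
    ; h-lift      = h-lift₂-ι₂
    ; h-other     = other
    }
    where
    other : ∀ j → (∀ l → lift₂ l ≢ j) → ∀ z → z ≢ B → h j (ι₂ z) ≡ ι₂ z
    other j not-lift₂ z z≢B with label-cover j
    ... | inj₂ (l , lift₂l≡j) = contradiction lift₂l≡j (not-lift₂ l)
    ... | inj₁ (l , refl) with B Data.Fin.≟ z
    ...   | yes B≡z = contradiction (sym B≡z) z≢B
    ...   | no _    = h-lift₁-inj₂ l _

  module B₁ = Branch branch₁
  module B₂ = Branch branch₂
  module P₁ = BranchPair branch₁ branch₂ lifts-disjoint vertex-cover
  module P₂ = BranchPair branch₂ branch₁ (λ l l′ → lifts-disjoint l′ l ∘ sym) (Data.Sum.swap ∘ vertex-cover)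

  module _ (σ-involutive : ∀ i x → σ i (σ i x) ≡ x) (τ-involutive : ∀ i x → τ i (τ i x) ≡ x) where

    h-involutive : ∀ j v → h j (h j v) ≡ v
    h-involutive j with label-cover j
    ... | inj₁ (l , refl) = P₁.lift-relation (l ∷ l ∷ []) (σ-involutive l)
    ... | inj₂ (l , refl) = P₂.lift-relation (l ∷ l ∷ []) (τ-involutive l)

    module _ (σ-pendant : PendantZero σ A) (τ-pendant : PendantZero τ B) where

      h-hub : FixesOrTransposes h C
      h-hub j with label-cover j
      ... | inj₁ (l , refl) = P₁.lift-FixesOrTransposes l (pendant⇒FixesOrTransposes σ-involutive σ-pendant l)
      ... | inj₂ (l , refl) = P₂.lift-FixesOrTransposes l (pendant⇒FixesOrTransposes τ-involutive τ-pendant l)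

      open Generation h h-involutive
      open Hub (≡-dec Data.Fin._≟_ Data.Fin._≟_) h h-involutive C h-hub

      assemble : ∀ {K g} → Injective _≡_ _≡_ g →
                 AgreesOffOrbit σ A (preimage lift₁ K) inj₁ g → AgreesOffOrbit τ B (preimage lift₂ K) ι₂ g →
                 InSubgroup h K g
      assemble {K} {g} g-injective (p , (u , u∈ , u≗p) , g≗p) (q , (w , w∈ , w≗q) , g≗q) =
        agreesOffOrbit⇒InSubgroup ∈-enumeration (InSubgroup-∘ F₂∈K F₁∈K) g-injective agree
        where
        open OrbitDecidable σ σ-involutive (preimage lift₁ K) A using () renaming (InOrbit? to InOrbit₁?)
        open OrbitDecidable τ τ-involutive (preimage lift₂ K) B using () renaming (InOrbit? to InOrbit₂?)
        module G₁ = Generation σ σ-involutive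
        module G₂ = Generation τ τ-involutive
        open ≡-Reasoning

        F₁ F₂ : V → V
        F₁ = eval h (Data.List.map lift₁ u)
        F₂ = eval h (Data.List.map lift₂ w)

        F₁∈K : InSubgroup h K F₁
        F₁∈K = Data.List.map lift₁ u , B₁.lift-WordIn u∈ , λ _ → refl

        F₂∈K : InSubgroup h K F₂
        F₂∈K = Data.List.map lift₂ w , B₂.lift-WordIn w∈ , λ _ → refl

        u∈′ : InSubgroup σ (preimage lift₁ K) (eval σ u)
        u∈′ = u , u∈ , λ _ → refl

        agree : ∀ v → InOrbit h K C v ⊎ g v ≡ F₂ (F₁ v)
        agree v with vertex-cover v
        ... | inj₁ (x , refl) with InOrbit₁? x
        ...   | yes o = inj₁ (B₁.lift-InOrbit o)
        ...   | no x∉ = inj₂ (begin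
          g (inj₁ x)              ≡⟨ g≗p x x∉ ⟩
          inj₁ (p x)              ≡⟨ cong inj₁ (u≗p x) ⟨
          inj₁ (eval σ u x)       ≡⟨ P₂.eval-lift-other w (G₁.∉Orbit⇒≢ (G₁.∉Orbit-InSubgroup u∈′ x∉)) ⟨
          F₂ (inj₁ (eval σ u x))  ≡⟨ cong F₂ (B₁.eval-lift u x) ⟨
          F₂ (F₁ (inj₁ x))        ∎)
        agree v | inj₂ (z , refl) with InOrbit₂? z
        ...   | yes o = inj₁ (B₂.lift-InOrbit o)
        ...   | no z∉ = inj₂ (begin
          g (ι₂ z)                ≡⟨ g≗q z z∉ ⟩
          ι₂ (q z)                ≡⟨ cong ι₂ (w≗q z) ⟨
          ι₂ (eval τ w z)         ≡⟨ B₂.eval-lift w z ⟨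
          F₂ (ι₂ z)               ≡⟨ cong F₂ (P₁.eval-lift-other u (G₂.∉Orbit⇒≢ z∉)) ⟨
          F₂ (F₁ (ι₂ z))          ∎)

      h-IntersectionProperty : IntersectionProperty σ → IntersectionProperty τ → IntersectionProperty h
      h-IntersectionProperty σ-ip τ-ip I J g g∈I g∈J =
        assemble g-injective
          (B₁.restrict-∩ σ-involutive σ-ip (pendant⇒FixesOrTransposes σ-involutive σ-pendant) g-injective g∈I g∈J)
          (B₂.restrict-∩ τ-involutive τ-ip (pendant⇒FixesOrTransposes τ-involutive τ-pendant) g-injective g∈I g∈J)
        where
        g-injective : Injective _≡_ _≡_ g
        g-injective = InSubgroup-injective g∈I

  h-IsLabelledGraph : IsLabelledGraph σ → IsLabelledGraph τ → IsLabelledGraph h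
  h-IsLabelledGraph (σ-involutive , σ-edges) (τ-involutive , τ-edges) =
    h-involutive σ-involutive τ-involutive , edges
    where
    edges : ∀ j → Σ V λ v → Σ V λ v′ → IsEdge h j v v′
    edges j with label-cover j
    ... | inj₁ (l , refl) = let x , y , e = σ-edges l in inj₁ x , inj₁ y , B₁.lift-edge e
    ... | inj₂ (l , refl) = let x , y , e = τ-edges l in ι₂ x , ι₂ y , B₂.lift-edge e

  toℕ-lift₁ : ∀ l → toℕ (lift₁ l) ≡ r ∸ toℕ l
  toℕ-lift₁ l = trans (toℕ-↑ˡ (opposite l) (suc r̃)) (opposite-prop l)

  toℕ-lift₂ : ∀ l → toℕ (lift₂ l) ≡ suc r + toℕ l
  toℕ-lift₂ l = toℕ-↑ʳ (suc r) l

  distance-lift₁ : ∀ l l′ → ∣ toℕ (lift₁ l) - toℕ (lift₁ l′) ∣ ≡ ∣ toℕ l - toℕ l′ ∣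
  distance-lift₁ l l′ = trans (cong₂ ∣_-_∣ (toℕ-lift₁ l) (toℕ-lift₁ l′))
                              (∣m∸n-m∸o∣≡∣n-o∣ (toℕ≤pred[n] l) (toℕ≤pred[n] l′))

  distance-lift₂ : ∀ l l′ → ∣ toℕ (lift₂ l) - toℕ (lift₂ l′) ∣ ≡ ∣ toℕ l - toℕ l′ ∣
  distance-lift₂ l l′ =
    trans (cong₂ ∣_-_∣ (toℕ-lift₂ l) (toℕ-lift₂ l′)) (∣m+n-m+o∣≡∣n-o∣ (suc r) (toℕ l) (toℕ l′))

  distance-lift₁-lift₂ : ∣ toℕ (lift₁ zero) - toℕ (lift₂ zero) ∣ ≡ 1
  distance-lift₁-lift₂ = trans (cong₂ ∣_-_∣ (toℕ-lift₁ zero) (trans (toℕ-lift₂ zero) (sym (+-suc r 0))))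
                               (∣m-m+n∣≡n r 1)

  h-IsSggi : IsSggi σ → IsSggi τ → PendantZero σ A → PendantZero τ B → IsSggi h
  h-IsSggi (σ-involutive , σ-moves , σ-relations) (τ-involutive , τ-moves , τ-relations) σ-pendant τ-pendant =
    h-inv , moves , relations
    where
    h-inv : ∀ j v → h j (h j v) ≡ v
    h-inv = h-involutive σ-involutive τ-involutive

    moves : ∀ j → Σ V λ v → h j v ≢ v
    moves j with label-cover j
    ... | inj₁ (l , refl) = let x , moved = σ-moves l in inj₁ x , B₁.lift-moves moved
    ... | inj₂ (l , refl) = let z , moved = τ-moves l in ι₂ z , B₂.lift-moves moved

    -- labels at distance ≥ 2 on different sides are not both 0, so one of them fixes the hub
    far-supports-disjoint : ∀ l l′ → 2 ≤ ∣ toℕ (lift₁ l) - toℕ (lift₂ l′) ∣ →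
                            ∀ v → h (lift₁ l) v ≡ v ⊎ h (lift₂ l′) v ≡ v
    far-supports-disjoint (suc l) l′       _ = P₁.supports-disjoint (proj₁ (proj₂ σ-pendant) (suc l) λ ()) l′
    far-supports-disjoint zero    (suc l′) _ =
      Data.Sum.swap ∘ P₂.supports-disjoint (proj₁ (proj₂ τ-pendant) (suc l′) λ ()) zero
    far-supports-disjoint zero    zero     far with subst (2 ≤_) distance-lift₁-lift₂ far
    ... | s≤s ()

    relations : ∀ i j → 2 ≤ ∣ toℕ i - toℕ j ∣ → ∀ v → h i (h j (h i (h j v))) ≡ v
    relations i j far with label-cover i | label-cover j
    ... | inj₁ (l , refl) | inj₁ (l′ , refl) =
      P₁.lift-relation (l ∷ l′ ∷ l ∷ l′ ∷ []) (σ-relations l l′ (subst (2 ≤_) (distance-lift₁ l l′) far))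
    ... | inj₂ (l , refl) | inj₂ (l′ , refl) =
      P₂.lift-relation (l ∷ l′ ∷ l ∷ l′ ∷ []) (τ-relations l l′ (subst (2 ≤_) (distance-lift₂ l l′) far))
    ... | inj₁ (l , refl) | inj₂ (l′ , refl) =
      disjoint-involutions⇒fgfg≡id (h-inv (lift₁ l)) (h-inv (lift₂ l′)) (far-supports-disjoint l l′ far)
    ... | inj₂ (l , refl) | inj₁ (l′ , refl) =
      disjoint-involutions⇒fgfg≡id (h-inv (lift₂ l)) (h-inv (lift₁ l′))
        (Data.Sum.swap ∘ far-supports-disjoint l′ l (subst (2 ≤_) (∣-∣-comm (toℕ (lift₂ l)) (toℕ (lift₁ l′))) far))

theorem1p1 : (r r̃ n₁ m : ℕ)
    (σ : Fin (suc r) → Fin n₁ → Fin n₁)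
    (τ : Fin (suc r̃) → Fin (suc m) → Fin (suc m))
    (A : Fin n₁) (B : Fin (suc m)) →
    IsCPRGraph σ → PendantZero σ A →
    IsCPRGraph τ → PendantZero τ B →
    IsCPRGraph (glue σ τ A B)
theorem1p1 r r̃ n₁ m σ τ A B (σ-graph , σ-sggi , σ-ip) σ-pendant (τ-graph , τ-sggi , τ-ip) τ-pendant =
  h-IsLabelledGraph σ-graph τ-graph ,
  h-IsSggi σ-sggi τ-sggi σ-pendant τ-pendant ,
  h-IntersectionProperty (proj₁ σ-graph) (proj₁ τ-graph) σ-pendant τ-pendant σ-ip τ-ip
  where open Glued σ τ A B
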